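{- Suppose that $[n]=\{1,\ldots,n\}$ is the disjoint union of subsets $X_1,\ldots,X_r$. Let $\mathcal{P}=\{(A_i,B_i):i\in[m]\}$ be a collection of pairs of subsets of $[n]$ such that $A_i\cap B_i=\emptyset$ for every $i\in[m]$ and $A_i\cap B_j\neq\emptyset$ for all $i<j$ in $[m]$. Let $a_{i,k}=|A_i\cap X_k|$ and $b_{i,k}=|B_i\cap X_k|$ for $i\in[m]$, $k\in[r]$. Then $$\sum_{i=1}^{m}\left[\prod_{k=1}^{r}\binom{a_{i,k}+b_{i,k}}{a_{i,k}}(1+a_{i,k}+b_{i,k})\right]^{ -1}\le 1.$$
   Context: $[m]=\{1,\ldots,m\}$. A collection of set pairs with the stated two properties is called a skew Bollobás system. -}

module Defs where

open import Data.Nat using (ℕ; zero; suc; _+_; _*_)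
open import Data.Nat.Combinatorics using (_C_)
open import Data.Fin using (Fin)
open import Data.Fin.Subset using (Subset; _∩_; ∣_∣; Empty; Nonempty)
open import Data.Integer using (+_)
open import Data.Rational using (ℚ; _/_; 0ℚ)
import Data.Rational as ℚ
open import Data.Vec.Functional using (foldr)
open import Relation.Binary.PropositionalEquality using (_≡_)
open import Data.Bool using (Bool; true; false)
open import Data.Vec using (tabulate)

-- X k  = the k-th block of the partition [n] = X_1 ⊔ ... ⊔ X_r,
-- encoded by a block-assignment function part : Fin n → Fin r.
block : ∀ {n r} → (Fin n → Fin r) → Fin r → Subset n
block {n} part k = tabulate λ x → isEq (part x) k
  where
  open import Data.Fin using (_≟_)
  open import Relation.Nullary using (does)
  isEq : ∀ {r} → Fin r → Fin r → Bool
  isEq a b = does (a ≟ b)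

Σℚ : ∀ {m} → (Fin m → ℚ) → ℚ
Σℚ f = foldr ℚ._+_ 0ℚ f

Πℕ : ∀ {r} → (Fin r → ℕ) → ℕ
Πℕ f = foldr _*_ 1 f

-- reciprocal of a natural number, applied only to positive numbers
-- in the statement (value at 0 is irrelevant and set to 0).
recip : ℕ → ℚ
recip zero    = 0ℚ
recip (suc k) = + 1 / suc k

SkewBollobas : ∀ {n m} → (Fin m → Subset n) → (Fin m → Subset n) → Set
SkewBollobas {n} {m} A B =
  (∀ i → Empty (A i ∩ B i)) ×
  (∀ i j → i Data.Fin.< j → Nonempty (A i ∩ B j))
  where open import Data.Product using (_×_)
        import Data.Fin

weight : ∀ {n r} → (Fin n → Fin r) → Subset n → Subset n → ℕ
weight part Ai Bi = Πℕ λ k →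
  let a = ∣ Ai ∩ block part k ∣
      b = ∣ Bi ∩ block part k ∣
  in ((a + b) C a) * (1 + a + b)

-- beta a b = 1 / (C(a+b, a) (1+a+b)) = a! b! / (a+b+1)! is the Beta integral of x^a (1-x)^b, so
-- beta a b = beta (a+1) b + beta a (b+1), and the product F(α, β) = ∏ₖ beta αₖ βₖ splits the same
-- way along every coordinate k. We show Σᵢ F(α + a_i, β + b_i) ≤ F(α, β) for every skew system and
-- all offsets α, β, by induction on n. The first point x lies in some block k and in at most one of
-- A_i, B_i. Splitting each term at coordinate k, the part with αₖ raised collects the pairs with
-- x ∉ B_i, the part with βₖ raised those with x ∉ A_i, and each of these two subsystems is again
-- skew on the remaining points. On the empty ground set a skew system has at most one pair, whose
-- term is F(α, β). Finally F(0, 0) = 1.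
module Submission where

open import Algebra.Bundles using (CommutativeMonoid)
open import Data.Empty using (⊥-elim)
open import Data.Fin using (Fin; zero; suc; _≟_)
open import Data.Fin.Subset using (Subset; _∩_; ∣_∣; Empty; Nonempty; inside; outside)
open import Data.Fin.Subset.Properties using (drop-∷-Empty)
open import Data.Integer using (+_) renaming (_+_ to _+ℤ_; _*_ to _*ℤ_)
import Data.Integer.Properties as ℤₚ
import Data.Integer.Tactic.RingSolver as ℤ-Solver
open import Data.List using (List; []; _∷_; tabulate)
open import Data.List.Relation.Unary.All using (All; []; _∷_)
import Data.List.Relation.Unary.All.Properties as All
open import Data.List.Relation.Unary.AllPairs using (AllPairs; []; _∷_)
import Data.List.Relation.Unary.AllPairs.Properties as AllPairs
open import Data.Nat as ℕ using (ℕ; zero; suc; _+_; _*_; _∸_; _!; NonZero)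
open import Data.Nat.Combinatorics using (_C_; nCk≡n!/k![n-k]!; k![n∸k]!∣n!)
open import Data.Nat.Coprimality using (1-coprimeTo)
open import Data.Nat.DivMod using (_/_; m/n*n≡m)
import Data.Nat.Properties as ℕₚ
open import Data.Nat.Tactic.RingSolver using (solve-∀)
open import Data.Product using (_×_; _,_)
open import Data.Rational as ℚ using (ℚ; mkℚ; 0ℚ; 1ℚ; _≤_)
import Data.Rational.Properties as ℚₚ
open import Data.Rational.Unnormalised using (*≡*)
import Data.Rational.Unnormalised.Properties as ℚᵘₚ
open import Data.Vec using ([]; _∷_; here; there)
open import Data.Vec.Functional using (foldr; updateAt; zipWith)
open import Data.Vec.Functional.Properties using (updateAt-updates; updateAt-minimal)
open import Function using (_∘_)
open import Relation.Binary.PropositionalEquality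
open import Relation.Nullary using (yes; no)

open import Defs

open import Algebra.Properties.CommutativeSemigroup ℕₚ.*-commutativeSemigroup
  using (xy∙z≈y∙xz)
open import Algebra.Properties.CommutativeSemigroup
  (CommutativeMonoid.commutativeSemigroup ℚₚ.+-0-commutativeMonoid)
  using (interchange; x∙yz≈y∙xz)

recip-suc : ∀ k → recip (suc k) ≡ mkℚ (+ 1) k (1-coprimeTo (suc k))
recip-suc k = ℚₚ.normalize-coprime (1-coprimeTo (suc k))

recip-nonNeg : ∀ n → 0ℚ ≤ recip n
recip-nonNeg zero    = ℚₚ.≤-refl
recip-nonNeg (suc n) = ℚₚ.nonNegative⁻¹ _ {{ℚₚ.normalize-nonNeg 1 (suc n)}}

recip-* : ∀ m n → recip (m * n) ≡ recip m ℚ.* recip n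
recip-* zero    n       = sym (ℚₚ.*-zeroˡ (recip n))
recip-* (suc m) zero    rewrite ℕₚ.*-zeroʳ m = sym (ℚₚ.*-zeroʳ (recip (suc m)))
recip-* (suc m) (suc n) rewrite recip-suc m | recip-suc n = refl

recip-harmonic : ∀ x y z .{{_ : NonZero x}} .{{_ : NonZero y}} .{{_ : NonZero z}} →
                 x * y ≡ (x + y) * z → recip z ≡ recip x ℚ.+ recip y
recip-harmonic x@(suc x-1) y@(suc y-1) z@(suc z-1) eq
  rewrite recip-suc x-1 | recip-suc y-1 | recip-suc z-1 =
  ℚₚ.toℚᵘ-injective
    (ℚᵘₚ.≃-trans (*≡* cross-multiplied) (ℚᵘₚ.≃-sym (ℚₚ.toℚᵘ-homo-+ 1/x 1/y)))
  where
  1/x = mkℚ (+ 1) x-1 (1-coprimeTo x)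
  1/y = mkℚ (+ 1) y-1 (1-coprimeTo y)
  reorder : ∀ a b c → (a +ℤ b) *ℤ c ≡ (+ 1 *ℤ b +ℤ + 1 *ℤ a) *ℤ c
  reorder = ℤ-Solver.solve-∀
  open ≡-Reasoning
  cross-multiplied : + 1 *ℤ + (x * y) ≡ (+ 1 *ℤ + y +ℤ + 1 *ℤ + x) *ℤ + z
  cross-multiplied = begin
    + 1 *ℤ + (x * y)                  ≡⟨ ℤₚ.*-identityˡ (+ (x * y)) ⟩
    + (x * y)                         ≡⟨ cong +_ eq ⟩
    + ((x + y) * z)                   ≡⟨ ℤₚ.pos-* (x + y) z ⟩
    + (x + y) *ℤ + z                  ≡⟨ cong (_*ℤ + z) (ℤₚ.pos-+ x y) ⟩
    (+ x +ℤ + y) *ℤ + z               ≡⟨ reorder (+ x) (+ y) (+ z) ⟩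
    (+ 1 *ℤ + y +ℤ + 1 *ℤ + x) *ℤ + z ∎

recip-Πℕ : ∀ {r} (h : Fin r → ℕ) → recip (Πℕ h) ≡ foldr ℚ._*_ 1ℚ (recip ∘ h)
recip-Πℕ {zero}  h = refl
recip-Πℕ {suc r} h =
  trans (recip-* (h zero) (Πℕ (h ∘ suc))) (cong (recip (h zero) ℚ.*_) (recip-Πℕ (h ∘ suc)))

-- If 1/x = p/d and 1/y = q/d then 1/z = (p + q)/d is 1/x + 1/y.
harmonic-cross : ∀ {p q x y z d} .{{_ : NonZero (p + q)}} →
                 p * x ≡ d → q * y ≡ d → (p + q) * z ≡ d → x * y ≡ (x + y) * z
harmonic-cross {p} {q} {x} {y} {z} {d} px≡d qy≡d [p+q]z≡d = ℕₚ.*-cancelʳ-≡ _ _ (p + q) (begin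
  x * y * (p + q)           ≡⟨ expand x y p q ⟩
  y * (p * x) + x * (q * y) ≡⟨ cong₂ (λ u v → y * u + x * v) px≡d qy≡d ⟩
  y * d + x * d             ≡⟨ cong₂ (λ u v → y * u + x * v) [p+q]z≡d [p+q]z≡d ⟨
  y * ((p + q) * z) + x * ((p + q) * z) ≡⟨ collect x y p q z ⟩
  (x + y) * z * (p + q)     ∎)
  where
  open ≡-Reasoning
  expand : ∀ x y p q → x * y * (p + q) ≡ y * (p * x) + x * (q * y)
  expand = solve-∀
  collect : ∀ x y p q z → y * ((p + q) * z) + x * ((p + q) * z) ≡ (x + y) * z * (p + q)
  collect = solve-∀

binomial-factorial : ∀ {n k} → k ℕ.≤ n → (n C k) * (k ! * (n ∸ k) !) ≡ n !
binomial-factorial {n} {k} k≤n = begin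
  (n C k) * (k ! * (n ∸ k) !)                 ≡⟨ cong (_* (k ! * (n ∸ k) !)) (nCk≡n!/k![n-k]! k≤n) ⟩
  n ! / (k ! * (n ∸ k) !) * (k ! * (n ∸ k) !) ≡⟨ m/n*n≡m (k![n∸k]!∣n! k≤n) ⟩
  n !                                         ∎
  where
  open ≡-Reasoning
  instance _ = k ℕₚ.!* (n ∸ k) !≢0

invBeta : ℕ → ℕ → ℕ
invBeta a b = ((a + b) C a) * (1 + a + b)

beta : ℕ → ℕ → ℚ
beta a b = recip (invBeta a b)

invBeta-factorial : ∀ a b → invBeta a b * (a ! * b !) ≡ suc (a + b) !
invBeta-factorial a b = begin
  ((a + b) C a) * suc (a + b) * (a ! * b !)
    ≡⟨ xy∙z≈y∙xz ((a + b) C a) (suc (a + b)) (a ! * b !) ⟩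
  suc (a + b) * (((a + b) C a) * (a ! * b !))
    ≡⟨ cong (λ c → suc (a + b) * (((a + b) C a) * (a ! * c !))) (ℕₚ.m+n∸m≡n a b) ⟨
  suc (a + b) * (((a + b) C a) * (a ! * (a + b ∸ a) !))
    ≡⟨ cong (suc (a + b) *_) (binomial-factorial (ℕₚ.m≤m+n a b)) ⟩
  suc (a + b) * (a + b) !
    ∎
  where open ≡-Reasoning

invBeta-nonZero : ∀ a b → NonZero (invBeta a b)
invBeta-nonZero a b =
  ℕₚ.m*n≢0⇒m≢0 (invBeta a b)
    {{subst NonZero (sym (invBeta-factorial a b)) (suc (a + b) ℕₚ.!≢0)}}

invBeta-sucˡ : ∀ a b → suc a * invBeta (suc a) b ≡ (2 + a + b) * invBeta a b
invBeta-sucˡ a b = ℕₚ.*-cancelʳ-≡ _ _ (a ! * b !) {{a ℕₚ.!* b !≢0}} (begin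
  suc a * invBeta (suc a) b * (a ! * b !)   ≡⟨ regroup (suc a) (invBeta (suc a) b) (a !) (b !) ⟩
  invBeta (suc a) b * (suc a ! * b !)       ≡⟨ invBeta-factorial (suc a) b ⟩
  (2 + a + b) * suc (a + b) !               ≡⟨ cong ((2 + a + b) *_) (invBeta-factorial a b) ⟨
  (2 + a + b) * (invBeta a b * (a ! * b !)) ≡⟨ ℕₚ.*-assoc (2 + a + b) (invBeta a b) (a ! * b !) ⟨
  (2 + a + b) * invBeta a b * (a ! * b !)   ∎)
  where
  open ≡-Reasoning
  regroup : ∀ s x f g → s * x * (f * g) ≡ x * (s * f * g)
  regroup = solve-∀

invBeta-sucʳ : ∀ a b → suc b * invBeta a (suc b) ≡ (2 + a + b) * invBeta a b
invBeta-sucʳ a b = ℕₚ.*-cancelʳ-≡ _ _ (a ! * b !) {{a ℕₚ.!* b !≢0}} (begin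
  suc b * invBeta a (suc b) * (a ! * b !)   ≡⟨ regroup (suc b) (invBeta a (suc b)) (a !) (b !) ⟩
  invBeta a (suc b) * (a ! * suc b !)       ≡⟨ invBeta-factorial a (suc b) ⟩
  suc (a + suc b) !                         ≡⟨ cong (λ c → suc c !) (ℕₚ.+-suc a b) ⟩
  (2 + a + b) * suc (a + b) !               ≡⟨ cong ((2 + a + b) *_) (invBeta-factorial a b) ⟨
  (2 + a + b) * (invBeta a b * (a ! * b !)) ≡⟨ ℕₚ.*-assoc (2 + a + b) (invBeta a b) (a ! * b !) ⟨
  (2 + a + b) * invBeta a b * (a ! * b !)   ∎)
  where
  open ≡-Reasoning
  regroup : ∀ s x f g → s * x * (f * g) ≡ x * (f * (s * g))
  regroup = solve-∀

beta-split : ∀ a b → beta a b ≡ beta (suc a) b ℚ.+ beta a (suc b)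
beta-split a b = recip-harmonic (invBeta (suc a) b) (invBeta a (suc b)) (invBeta a b)
  {{invBeta-nonZero (suc a) b}} {{invBeta-nonZero a (suc b)}} {{invBeta-nonZero a b}}
  (harmonic-cross {suc a} {suc b} (invBeta-sucˡ a b) (invBeta-sucʳ a b) [a+1+b+1]z≡d)
  where
  [a+1+b+1]z≡d : (suc a + suc b) * invBeta a b ≡ (2 + a + b) * invBeta a b
  [a+1+b+1]z≡d = cong (λ c → suc c * invBeta a b) (ℕₚ.+-suc a b)

beta-nonNeg : ∀ a b → 0ℚ ≤ beta a b
beta-nonNeg a b = recip-nonNeg (invBeta a b)

productWeight : ∀ {r} → (ℕ → ℕ → ℚ) → (Fin r → ℕ) → (Fin r → ℕ) → ℚ
productWeight f α β = foldr ℚ._*_ 1ℚ (λ k → f (α k) (β k))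

module _ (f : ℕ → ℕ → ℚ) where

  productWeight-cong : ∀ {r} {α α′ β β′ : Fin r → ℕ} → α ≗ α′ → β ≗ β′ →
                       productWeight f α β ≡ productWeight f α′ β′
  productWeight-cong {zero}  α≗α′ β≗β′ = refl
  productWeight-cong {suc r} α≗α′ β≗β′ =
    cong₂ ℚ._*_ (cong₂ f (α≗α′ zero) (β≗β′ zero))
                (productWeight-cong (α≗α′ ∘ suc) (β≗β′ ∘ suc))

  productWeight-nonNeg : (∀ a b → 0ℚ ≤ f a b) →
                         ∀ {r} (α β : Fin r → ℕ) → 0ℚ ≤ productWeight f α β
  productWeight-nonNeg f-nonNeg {zero}  α β = ℚₚ.nonNegative⁻¹ 1ℚ
  productWeight-nonNeg f-nonNeg {suc r} α β =
    ℚₚ.nonNegative⁻¹ (x ℚ.* y)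
      {{ℚₚ.nonNeg*nonNeg⇒nonNeg x {{ℚ.nonNegative 0≤x}} y {{ℚ.nonNegative 0≤y}}}}
    where
    x = f (α zero) (β zero)
    y = productWeight f (α ∘ suc) (β ∘ suc)
    0≤x = f-nonNeg (α zero) (β zero)
    0≤y = productWeight-nonNeg f-nonNeg (α ∘ suc) (β ∘ suc)

  productWeight-split : (∀ a b → f a b ≡ f (suc a) b ℚ.+ f a (suc b)) →
                        ∀ {r} (k : Fin r) (α β : Fin r → ℕ) →
                        productWeight f α β ≡
                        productWeight f (updateAt α k suc) β ℚ.+ productWeight f α (updateAt β k suc)
  productWeight-split f-split {suc r} zero α β =
    trans (cong (ℚ._* rest) (f-split a b)) (ℚₚ.*-distribʳ-+ rest (f (suc a) b) (f a (suc b)))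
    where
    a = α zero
    b = β zero
    rest = productWeight f (α ∘ suc) (β ∘ suc)
  productWeight-split f-split {suc r} (suc k) α β =
    trans (cong (f₀ ℚ.*_) (productWeight-split f-split k (α ∘ suc) (β ∘ suc)))
          (ℚₚ.*-distribˡ-+ f₀ (productWeight f (updateAt (α ∘ suc) k suc) (β ∘ suc))
                              (productWeight f (α ∘ suc) (updateAt (β ∘ suc) k suc)))
    where f₀ = f (α zero) (β zero)

  productWeight-zero : f 0 0 ≡ 1ℚ → ∀ {r} → productWeight {r} f (λ _ → 0) (λ _ → 0) ≡ 1ℚ
  productWeight-zero f00≡1 {zero}  = refl
  productWeight-zero f00≡1 {suc r} =
    trans (cong₂ ℚ._*_ f00≡1 (productWeight-zero f00≡1 {r})) (ℚₚ.*-identityˡ 1ℚ)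

updateAt-zipWith-+ˡ : ∀ {r} (u v : Fin r → ℕ) k →
                      updateAt (zipWith _+_ u v) k suc ≗ zipWith _+_ (updateAt u k suc) v
updateAt-zipWith-+ˡ u v zero    zero    = refl
updateAt-zipWith-+ˡ u v zero    (suc j) = refl
updateAt-zipWith-+ˡ u v (suc k) zero    = refl
updateAt-zipWith-+ˡ u v (suc k) (suc j) = updateAt-zipWith-+ˡ (u ∘ suc) (v ∘ suc) k j

zipWith-+-updateAt-suc : ∀ {r} (u v : Fin r → ℕ) k →
                         zipWith _+_ u (updateAt v k suc) ≗ zipWith _+_ (updateAt u k suc) v
zipWith-+-updateAt-suc u v zero    zero    = ℕₚ.+-suc (u zero) (v zero)
zipWith-+-updateAt-suc u v zero    (suc j) = refl
zipWith-+-updateAt-suc u v (suc k) zero    = refl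
zipWith-+-updateAt-suc u v (suc k) (suc j) = zipWith-+-updateAt-suc (u ∘ suc) (v ∘ suc) k j

profile : ∀ {n r} → (Fin n → Fin r) → Subset n → Fin r → ℕ
profile part A k = ∣ A ∩ block part k ∣

profile-inside : ∀ {n r} (part : Fin (suc n) → Fin r) (A : Subset n) →
                 profile part (inside ∷ A) ≗ updateAt (profile (part ∘ suc) A) (part zero) suc
profile-inside part A j with part zero ≟ j
... | yes refl = sym (updateAt-updates (part zero) (profile (part ∘ suc) A))
... | no  k≢j  = sym (updateAt-minimal j (part zero) (profile (part ∘ suc) A) (k≢j ∘ sym))

zipWith-+-profile-inside : ∀ {n r} (part : Fin (suc n) → Fin r) (α : Fin r → ℕ) (A : Subset n) →
                           zipWith _+_ α (profile part (inside ∷ A)) ≗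
                           zipWith _+_ (updateAt α (part zero) suc) (profile (part ∘ suc) A)
zipWith-+-profile-inside part α A j =
  trans (cong (_+_ (α j)) (profile-inside part A j))
        (zipWith-+-updateAt-suc α (profile (part ∘ suc) A) (part zero) j)

SetPair : ℕ → Set
SetPair n = Subset n × Subset n

Disjoint : ∀ {n} → SetPair n → Set
Disjoint (A , B) = Empty (A ∩ B)

Meets : ∀ {n} → SetPair n → SetPair n → Set
Meets (A , _) (_ , B) = Nonempty (A ∩ B)

-- Lists rather than Fin m-indexed families, because the induction discards pairs.
SkewSystem : ∀ {n} → List (SetPair n) → Set
SkewSystem ps = All Disjoint ps × AllPairs Meets ps

Nonempty-outside : ∀ {n} {p : Subset n} → Nonempty (outside ∷ p) → Nonempty p
Nonempty-outside (suc x , there x∈p) = x , x∈p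

tailsAvoidingB : ∀ {n} → List (SetPair (suc n)) → List (SetPair n)
tailsAvoidingB []                           = []
tailsAvoidingB ((_ ∷ A , inside  ∷ B) ∷ ps) = tailsAvoidingB ps
tailsAvoidingB ((_ ∷ A , outside ∷ B) ∷ ps) = (A , B) ∷ tailsAvoidingB ps

tailsAvoidingA : ∀ {n} → List (SetPair (suc n)) → List (SetPair n)
tailsAvoidingA []                           = []
tailsAvoidingA ((inside  ∷ A , _ ∷ B) ∷ ps) = tailsAvoidingA ps
tailsAvoidingA ((outside ∷ A , _ ∷ B) ∷ ps) = (A , B) ∷ tailsAvoidingA ps

module _ {n} {P : SetPair (suc n) → Set} {Q : SetPair n → Set} where

  All-tailsAvoidingB : (∀ {a A B} → P (a ∷ A , outside ∷ B) → Q (A , B)) →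
                       ∀ {ps} → All P ps → All Q (tailsAvoidingB ps)
  All-tailsAvoidingB P⇒Q {[]}                         []         = []
  All-tailsAvoidingB P⇒Q {(_ ∷ A , inside  ∷ B) ∷ ps} (_  ∷ Pps) = All-tailsAvoidingB P⇒Q Pps
  All-tailsAvoidingB P⇒Q {(_ ∷ A , outside ∷ B) ∷ ps} (Pp ∷ Pps) = P⇒Q Pp ∷ All-tailsAvoidingB P⇒Q Pps

  All-tailsAvoidingA : (∀ {b A B} → P (outside ∷ A , b ∷ B) → Q (A , B)) →
                       ∀ {ps} → All P ps → All Q (tailsAvoidingA ps)
  All-tailsAvoidingA P⇒Q {[]}                         []         = []
  All-tailsAvoidingA P⇒Q {(inside  ∷ A , _ ∷ B) ∷ ps} (_  ∷ Pps) = All-tailsAvoidingA P⇒Q Pps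
  All-tailsAvoidingA P⇒Q {(outside ∷ A , _ ∷ B) ∷ ps} (Pp ∷ Pps) = P⇒Q Pp ∷ All-tailsAvoidingA P⇒Q Pps

AllPairs-tailsAvoidingB : ∀ {n} {ps : List (SetPair (suc n))} →
                          AllPairs Meets ps → AllPairs Meets (tailsAvoidingB ps)
AllPairs-tailsAvoidingB {ps = []}                         []         = []
AllPairs-tailsAvoidingB {ps = (_ ∷ A , inside  ∷ B) ∷ ps} (_  ∷ Mps) = AllPairs-tailsAvoidingB Mps
AllPairs-tailsAvoidingB {ps = (a ∷ A , outside ∷ B) ∷ ps} (Mp ∷ Mps) =
  All-tailsAvoidingB (meets-tail a) Mp ∷ AllPairs-tailsAvoidingB Mps
  where
  meets-tail : ∀ a {A B′ : Subset _} → Nonempty ((a ∷ A) ∩ (outside ∷ B′)) → Nonempty (A ∩ B′)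
  meets-tail inside  = Nonempty-outside
  meets-tail outside = Nonempty-outside

AllPairs-tailsAvoidingA : ∀ {n} {ps : List (SetPair (suc n))} →
                          AllPairs Meets ps → AllPairs Meets (tailsAvoidingA ps)
AllPairs-tailsAvoidingA {ps = []}                         []         = []
AllPairs-tailsAvoidingA {ps = (inside  ∷ A , _ ∷ B) ∷ ps} (_  ∷ Mps) = AllPairs-tailsAvoidingA Mps
AllPairs-tailsAvoidingA {ps = (outside ∷ A , _ ∷ B) ∷ ps} (Mp ∷ Mps) =
  All-tailsAvoidingA Nonempty-outside Mp ∷ AllPairs-tailsAvoidingA Mps

SkewSystem-tailsAvoidingB : ∀ {n} {ps : List (SetPair (suc n))} →
                            SkewSystem ps → SkewSystem (tailsAvoidingB ps)
SkewSystem-tailsAvoidingB (disjoint , meets) =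
  All-tailsAvoidingB drop-∷-Empty disjoint , AllPairs-tailsAvoidingB meets

SkewSystem-tailsAvoidingA : ∀ {n} {ps : List (SetPair (suc n))} →
                            SkewSystem ps → SkewSystem (tailsAvoidingA ps)
SkewSystem-tailsAvoidingA (disjoint , meets) =
  All-tailsAvoidingA drop-∷-Empty disjoint , AllPairs-tailsAvoidingA meets

sumMap : ∀ {A : Set} → (A → ℚ) → List A → ℚ
sumMap w []       = 0ℚ
sumMap w (x ∷ xs) = w x ℚ.+ sumMap w xs

Σℚ-tabulate : ∀ {A : Set} {m} {g : Fin m → ℚ} (w : A → ℚ) (xs : Fin m → A) →
              (∀ i → g i ≡ w (xs i)) → Σℚ g ≡ sumMap w (tabulate xs)
Σℚ-tabulate {m = zero}  w xs g≗w∘xs = refl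
Σℚ-tabulate {m = suc m} w xs g≗w∘xs =
  cong₂ ℚ._+_ (g≗w∘xs zero) (Σℚ-tabulate w (xs ∘ suc) (g≗w∘xs ∘ suc))

module HarmonicWeight {r} (F : (Fin r → ℕ) → (Fin r → ℕ) → ℚ)
  (F-cong : ∀ {α α′ β β′} → α ≗ α′ → β ≗ β′ → F α β ≡ F α′ β′)
  (F-nonNeg : ∀ α β → 0ℚ ≤ F α β)
  (F-split : ∀ k α β → F α β ≡ F (updateAt α k suc) β ℚ.+ F α (updateAt β k suc))
  where

  shiftedWeight : ∀ {n} → (Fin n → Fin r) → (Fin r → ℕ) → (Fin r → ℕ) → SetPair n → ℚ
  shiftedWeight part α β (A , B) = F (zipWith _+_ α (profile part A)) (zipWith _+_ β (profile part B))

  module _ {n} (part : Fin (suc n) → Fin r) (α β : Fin r → ℕ) where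

    private
      k = part zero
      W  = shiftedWeight part α β
      Wᴬ = shiftedWeight (part ∘ suc) (updateAt α k suc) β
      Wᴮ = shiftedWeight (part ∘ suc) α (updateAt β k suc)
      Sᴬ = λ ps → sumMap Wᴬ (tailsAvoidingB ps)
      Sᴮ = λ ps → sumMap Wᴮ (tailsAvoidingA ps)

    shiftedWeight-insideA : ∀ A B → W (inside ∷ A , outside ∷ B) ≡ Wᴬ (A , B)
    shiftedWeight-insideA A B = F-cong (zipWith-+-profile-inside part α A) (λ _ → refl)

    shiftedWeight-insideB : ∀ A B → W (outside ∷ A , inside ∷ B) ≡ Wᴮ (A , B)
    shiftedWeight-insideB A B = F-cong (λ _ → refl) (zipWith-+-profile-inside part β B)

    shiftedWeight-outside : ∀ A B → W (outside ∷ A , outside ∷ B) ≡ Wᴬ (A , B) ℚ.+ Wᴮ (A , B)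
    shiftedWeight-outside A B = trans (F-split k _ _)
      (cong₂ ℚ._+_ (F-cong (updateAt-zipWith-+ˡ α (profile (part ∘ suc) A) k) (λ _ → refl))
                   (F-cong (λ _ → refl) (updateAt-zipWith-+ˡ β (profile (part ∘ suc) B) k)))

    sumMap-shiftedWeight-split : ∀ ps → All Disjoint ps → sumMap W ps ≡ Sᴬ ps ℚ.+ Sᴮ ps
    sumMap-shiftedWeight-split [] [] = sym (ℚₚ.+-identityʳ 0ℚ)
    sumMap-shiftedWeight-split ((inside ∷ A , inside ∷ B) ∷ ps) (A∩B≡∅ ∷ _) =
      ⊥-elim (A∩B≡∅ (zero , here))
    sumMap-shiftedWeight-split ((inside ∷ A , outside ∷ B) ∷ ps) (_ ∷ disjoint) =
      trans (cong₂ ℚ._+_ (shiftedWeight-insideA A B) (sumMap-shiftedWeight-split ps disjoint))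
            (sym (ℚₚ.+-assoc (Wᴬ (A , B)) (Sᴬ ps) (Sᴮ ps)))
    sumMap-shiftedWeight-split ((outside ∷ A , inside ∷ B) ∷ ps) (_ ∷ disjoint) =
      trans (cong₂ ℚ._+_ (shiftedWeight-insideB A B) (sumMap-shiftedWeight-split ps disjoint))
            (x∙yz≈y∙xz (Wᴮ (A , B)) (Sᴬ ps) (Sᴮ ps))
    sumMap-shiftedWeight-split ((outside ∷ A , outside ∷ B) ∷ ps) (_ ∷ disjoint) =
      trans (cong₂ ℚ._+_ (shiftedWeight-outside A B) (sumMap-shiftedWeight-split ps disjoint))
            (interchange (Wᴬ (A , B)) (Wᴮ (A , B)) (Sᴬ ps) (Sᴮ ps))

  sumMap-shiftedWeight≤ : ∀ {n} (part : Fin n → Fin r) α β ps → SkewSystem ps →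
                          sumMap (shiftedWeight part α β) ps ≤ F α β
  sumMap-shiftedWeight≤ {zero} part α β [] _ = F-nonNeg α β
  sumMap-shiftedWeight≤ {zero} part α β (([] , []) ∷ []) _ = ℚₚ.≤-reflexive (begin
    shiftedWeight part α β ([] , []) ℚ.+ 0ℚ
      ≡⟨ ℚₚ.+-identityʳ _ ⟩
    F (λ j → α j + 0) (λ j → β j + 0)
      ≡⟨ F-cong (ℕₚ.+-identityʳ ∘ α) (ℕₚ.+-identityʳ ∘ β) ⟩
    F α β
      ∎)
    where open ≡-Reasoning
  sumMap-shiftedWeight≤ {zero} part α β (_ ∷ _ ∷ _) (_ , ((() , _) ∷ _) ∷ _)
  sumMap-shiftedWeight≤ {suc n} part α β ps skew@(disjoint , _) = begin
    sumMap (shiftedWeight part α β) ps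
      ≡⟨ sumMap-shiftedWeight-split part α β ps disjoint ⟩
    sumMap (shiftedWeight part′ (updateAt α k suc) β) (tailsAvoidingB ps) ℚ.+
    sumMap (shiftedWeight part′ α (updateAt β k suc)) (tailsAvoidingA ps)
      ≤⟨ ℚₚ.+-mono-≤
           (sumMap-shiftedWeight≤ part′ (updateAt α k suc) β _ (SkewSystem-tailsAvoidingB skew))
           (sumMap-shiftedWeight≤ part′ α (updateAt β k suc) _ (SkewSystem-tailsAvoidingA skew)) ⟩
    F (updateAt α k suc) β ℚ.+ F α (updateAt β k suc)
      ≡⟨ F-split k α β ⟨
    F α β ∎
    where
    open ℚₚ.≤-Reasoning
    k = part zero
    part′ = part ∘ suc

module BetaWeight {r} = HarmonicWeight {r} (productWeight beta) (productWeight-cong beta)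
  (productWeight-nonNeg beta beta-nonNeg) (productWeight-split beta beta-split)
open BetaWeight

recip-weight : ∀ {n r} (part : Fin n → Fin r) A B →
               recip (weight part A B) ≡ shiftedWeight part (λ _ → 0) (λ _ → 0) (A , B)
recip-weight part A B = recip-Πℕ (λ k → invBeta (profile part A k) (profile part B k))

corollary1p8 : (n r m : ℕ) (part : Fin n → Fin r)
    (A B : Fin m → Subset n) →
    SkewBollobas A B →
    Σℚ (λ i → recip (weight part (A i) (B i))) ≤ 1ℚ
corollary1p8 n r m part A B (disjoint , meets) = begin
  Σℚ (λ i → recip (weight part (A i) (B i)))
    ≡⟨ Σℚ-tabulate (shiftedWeight part 0⃗ 0⃗) pairs (λ i → recip-weight part (A i) (B i)) ⟩
  sumMap (shiftedWeight part 0⃗ 0⃗) (tabulate pairs)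
    ≤⟨ sumMap-shiftedWeight≤ part 0⃗ 0⃗ (tabulate pairs) skew ⟩
  productWeight beta 0⃗ 0⃗
    ≡⟨ productWeight-zero beta refl {r} ⟩
  1ℚ ∎
  where
  open ℚₚ.≤-Reasoning
  0⃗ : Fin r → ℕ
  0⃗ _ = 0
  pairs : Fin m → SetPair n
  pairs i = A i , B i
  skew : SkewSystem (tabulate pairs)
  skew = All.tabulate⁺ disjoint , AllPairs.tabulate⁺-< (meets _ _)
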